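{- Let $u\in[2]^n$ (a word of length $n$ over $\{1,2\}$), and let $w$ be a word over the positive integers such that $P(w)$ has at least two rows and $\max R_i(w)\le 2$ for $i\le 2$. Let $\overline{w}$ be the restriction of $w$ to ones and twos. Then: (a) for $i\le 2$, $R_i(wu)=R_i(\overline{w}u)$ and $R_i(uw)=R_i(u\overline{w})$; (b) for $i\ge 3$, $R_i(wu)=R_i(w)=R_i(uw)$.
   Context: Juxtaposition denotes concatenation of words. $P(w)$ is the insertion tableau of $w$ under the Robinson–Schensted–Knuth (row-insertion) correspondence. $R_i(w)$ denotes the $i$th row of $P(w)$ (empty if $P(w)$ has fewer than $i$ rows). The restriction of $w$ to ones and twos is the subsequence $\overline{w}$ of $w$ obtained by deleting all letters greater than or equal to $3$. -}

module Defs where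

open import Data.Nat using (ℕ; zero; suc; _<ᵇ_; _≤?_)
open import Data.Bool using (if_then_else_)
open import Data.Maybe using (Maybe; just; nothing)
open import Data.Product using (_×_; _,_)
open import Data.List using (List; []; _∷_; foldl; filter)

-- A word over the positive integers / a row / a tableau (list of rows, top row first).
Word : Set
Word = List ℕ

Tableau : Set
Tableau = List (List ℕ)

insertRow : ℕ → List ℕ → Maybe ℕ × List ℕ
insertRow x [] = nothing , x ∷ []
insertRow x (y ∷ ys) with x <ᵇ y
... | Data.Bool.true  = just y , x ∷ ys
... | Data.Bool.false with insertRow x ys
...   | b , r = b , y ∷ r

insert : ℕ → Tableau → Tableau
insert x [] = (x ∷ []) ∷ []
insert x (r ∷ rs) with insertRow x r
... | nothing , r' = r' ∷ rs
... | just y  , r' = r' ∷ insert y rs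

P : Word → Tableau
P w = foldl (λ T x → insert x T) [] w

rowAt : ℕ → Tableau → List ℕ
rowAt _ [] = []
rowAt zero (r ∷ _) = r
rowAt (suc i) (_ ∷ rs) = rowAt i rs

-- R i w : the i-th row (1-indexed) of P(w); meaningful for i ≥ 1.
R : ℕ → Word → List ℕ
R zero w = []
R (suc i) w = rowAt i (P w)

restrict12 : Word → Word
restrict12 = filter (_≤? 2)

module Submission where

-- Inserting a letter y ∈ {1, 2} into a tableau whose first two rows hold only 1s and 2s bumps nothing
-- out of the second row, so appending u changes only the first two rows, which stay within {1, 2}.
-- Prepending is a simulation along z: a leading 1 sits at the front of the first row forever, and a
-- leading 2 behaves like an extra 2 at the front of the second row of P(z): at every stage the top two
-- rows of P(2z) are obtained from those of P(z), with that extra 2, by sliding one entry of the second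
-- row straight up into the first, and the same letter leaves the second row, so lower rows agree.
-- Finally, row by row, the entries ≤ k of P(w) form P of the restriction of w to letters ≤ k; since
-- the first two rows of P(wu) and P(uw) contain only 1s and 2s, this gives (a).

open import Data.Nat using (ℕ; zero; suc; _+_; _≤_; _<_; _>_; _<ᵇ_; _≤?_; _<?_; z≤n; s≤s)
open import Data.Nat.Properties
open import Data.Bool using (true; false)
open import Data.Maybe using (Maybe; just; nothing)
import Data.Maybe.Relation.Unary.All as Maybe
open import Data.List using (List; []; _∷_; [_]; _++_; length; drop; filter; map; foldl)
open import Data.List.Properties
  using (++-assoc; ++-identityʳ; length-++; foldl-++;
         filter-++; filter-all; filter-none; filter-accept; filter-reject)
open import Data.List.Relation.Unary.All using (All; []; _∷_)
import Data.List.Relation.Unary.All as All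
import Data.List.Relation.Unary.All.Properties as All
open import Data.List.Relation.Unary.AllPairs using (AllPairs; []; _∷_)
open import Data.List.Relation.Binary.Pointwise using (Pointwise; []; _∷_)
open import Data.List.Relation.Binary.Prefix.Heterogeneous using (Prefix; []; _∷_)
open import Data.Product using (_×_; _,_; proj₁; proj₂; ∃₂; map₂)
open import Data.Sum using (_⊎_; inj₁; inj₂)
open import Function using (_∘_)
open import Relation.Nullary using (yes; no; contradiction)
open import Relation.Nullary.Reflects using (ofʸ; ofⁿ)
open import Relation.Binary.PropositionalEquality
  using (_≡_; refl; sym; trans; cong; cong₂; subst; subst₂; module ≡-Reasoning)
open import Defs

-- Row insertion

Sorted : List ℕ → Set
Sorted = AllPairs _≤_

insertRow-bump : ∀ {y e} r → y < e → insertRow y (e ∷ r) ≡ (just e , y ∷ r)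
insertRow-bump {y} {e} r y<e with y <ᵇ e | <ᵇ-reflects-< y e
... | true  | _       = refl
... | false | ofⁿ y≮e = contradiction y<e y≮e

insertRow-pass : ∀ {y e} r → e ≤ y → insertRow y (e ∷ r) ≡ map₂ (e ∷_) (insertRow y r)
insertRow-pass {y} {e} r e≤y with y <ᵇ e | <ᵇ-reflects-< y e
... | true  | ofʸ y<e = contradiction e≤y (<⇒≱ y<e)
... | false | _       = refl

insertRow-++ʳ : ∀ {y} xs ys → All (_≤ y) xs → insertRow y (xs ++ ys) ≡ map₂ (xs ++_) (insertRow y ys)
insertRow-++ʳ []       ys []           = refl
insertRow-++ʳ (x ∷ xs) ys (x≤y ∷ xs≤y) =
  trans (insertRow-pass (xs ++ ys) x≤y) (cong (map₂ (x ∷_)) (insertRow-++ʳ xs ys xs≤y))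

insertRow-append : ∀ {y} xs → All (_≤ y) xs → insertRow y xs ≡ (nothing , xs ++ [ y ])
insertRow-append {y} xs xs≤y =
  subst (λ zs → insertRow y zs ≡ (nothing , xs ++ [ y ])) (++-identityʳ xs) (insertRow-++ʳ xs [] xs≤y)

insertRow-++ˡ : ∀ {y b xs′} xs ys → insertRow y xs ≡ (just b , xs′) →
                insertRow y (xs ++ ys) ≡ (just b , xs′ ++ ys)
insertRow-++ˡ {y} (x ∷ xs) ys eq with y <ᵇ x | <ᵇ-reflects-< y x
insertRow-++ˡ {y} (x ∷ xs) ys refl | true | _ = refl
... | false | ofⁿ y≮x with insertRow y xs in e
insertRow-++ˡ {y} (x ∷ xs) ys refl | false | ofⁿ y≮x | just b , r =
  cong (map₂ (x ∷_)) (insertRow-++ˡ xs ys e)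

insertRow-nothing⇒≤ : ∀ {y r′} xs → insertRow y xs ≡ (nothing , r′) → All (_≤ y) xs
insertRow-nothing⇒≤ [] _ = []
insertRow-nothing⇒≤ {y} (x ∷ xs) eq with y <ᵇ x | <ᵇ-reflects-< y x
... | false | ofⁿ y≮x with insertRow y xs in e
insertRow-nothing⇒≤ {y} (x ∷ xs) refl | false | ofⁿ y≮x | nothing , r =
  ≮⇒≥ y≮x ∷ insertRow-nothing⇒≤ xs e

insertRow-bumped> : ∀ y r → Maybe.All (y <_) (proj₁ (insertRow y r))
insertRow-bumped> y [] = Maybe.nothing
insertRow-bumped> y (x ∷ xs) with y <ᵇ x | <ᵇ-reflects-< y x
... | true  | ofʸ y<x = Maybe.just y<x
... | false | _       = insertRow-bumped> y xs

insertRow-bumped-All : ∀ {P : ℕ → Set} y {r} → All P r → Maybe.All P (proj₁ (insertRow y r))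
insertRow-bumped-All y [] = Maybe.nothing
insertRow-bumped-All y {x ∷ xs} (px ∷ pxs) with y <ᵇ x
... | true  = Maybe.just px
... | false = insertRow-bumped-All y pxs

insertRow-All : ∀ {P : ℕ → Set} {y r} → P y → All P r → All P (proj₂ (insertRow y r))
insertRow-All py [] = py ∷ []
insertRow-All {y = y} {x ∷ xs} py (px ∷ pxs) with y <ᵇ x
... | true  = py ∷ pxs
... | false = px ∷ insertRow-All py pxs

insertRow-length : ∀ {y b xs′} xs → insertRow y xs ≡ (just b , xs′) → length xs′ ≡ length xs
insertRow-length {y} (x ∷ xs) eq with y <ᵇ x
insertRow-length {y} (x ∷ xs) refl | true = refl
... | false with insertRow y xs in e
insertRow-length {y} (x ∷ xs) refl | false | just b , r = cong suc (insertRow-length xs e)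

insertRow-sorted : ∀ y {r} → Sorted r → Sorted (proj₂ (insertRow y r))
insertRow-sorted y [] = [] ∷ []
insertRow-sorted y {x ∷ xs} (x≤xs ∷ sxs) with y <ᵇ x | <ᵇ-reflects-< y x
... | true  | ofʸ y<x = All.map (≤-trans (<⇒≤ y<x)) x≤xs ∷ sxs
... | false | ofⁿ y≮x = insertRow-All (≮⇒≥ y≮x) x≤xs ∷ insertRow-sorted y sxs

sorted-before : ∀ xs {e ys} → Sorted (xs ++ e ∷ ys) → All (_≤ e) xs
sorted-before []       _                = []
sorted-before (x ∷ xs) (x≤rest ∷ sorted) with All.++⁻ʳ xs x≤rest
... | x≤e ∷ _ = x≤e ∷ sorted-before xs sorted

sorted-after : ∀ xs {e ys} → Sorted (xs ++ e ∷ ys) → All (e ≤_) ys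
sorted-after []       (e≤ys ∷ _) = e≤ys
sorted-after (x ∷ xs) (_ ∷ sorted) = sorted-after xs sorted

prefix-++⁻ˡ : ∀ {R : ℕ → ℕ → Set} cs as {cs′ as′} → length cs ≡ length as →
              Prefix R (cs ++ cs′) (as ++ as′) → Pointwise R cs as
prefix-++⁻ˡ []       []       _   _        = []
prefix-++⁻ˡ (c ∷ cs) (a ∷ as) len (r ∷ rs) = r ∷ prefix-++⁻ˡ cs as (suc-injective len) rs

prefix-shifted : ∀ {R : ℕ → ℕ → Set} cs as {z e cs′ as′} → length cs ≡ length as →
                 Prefix R (cs ++ e ∷ cs′) (z ∷ as ++ as′) → Prefix R cs′ as′
prefix-shifted []       []       _   (_ ∷ rs) = rs
prefix-shifted (_ ∷ cs) (_ ∷ as) len (_ ∷ rs) = prefix-shifted cs as (suc-injective len) rs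

insertRow-below : ∀ y {r₁ r₂} → Prefix _>_ r₂ r₁ → Prefix _>_ r₂ (proj₂ (insertRow y r₁))
insertRow-below y [] = []
insertRow-below y {a ∷ as} (a<c ∷ below) with y <ᵇ a | <ᵇ-reflects-< y a
... | true  | ofʸ y<a = <-trans y<a a<c ∷ below
... | false | _       = a<c ∷ insertRow-below y below

insertRow-below-bumped : ∀ y {r₁ r₂ b r₁′} → Prefix _>_ r₂ r₁ →
                         insertRow y r₁ ≡ (just b , r₁′) → Prefix _>_ (proj₂ (insertRow b r₂)) r₁′
insertRow-below-bumped y {a ∷ as} {r₂} below eq with y <ᵇ a | <ᵇ-reflects-< y a
insertRow-below-bumped y {a ∷ as} {[]}     below         refl | true | ofʸ y<a = y<a ∷ []
insertRow-below-bumped y {a ∷ as} {c ∷ cs} (a<c ∷ below) refl | true | ofʸ y<a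
  rewrite insertRow-bump cs a<c = y<a ∷ below
... | false | ofⁿ y≮a with insertRow y as in e | insertRow-bumped> y as
insertRow-below-bumped y {a ∷ as} {[]} below refl | false | ofⁿ y≮a | just b , r | Maybe.just y<b =
  ≤-<-trans (≮⇒≥ y≮a) y<b ∷ []
insertRow-below-bumped y {a ∷ as} {c ∷ cs} (a<c ∷ below) refl | false | ofⁿ y≮a | just b , r | Maybe.just y<b
  with b <ᵇ c
... | true  = ≤-<-trans (≮⇒≥ y≮a) y<b ∷ subst (Prefix _>_ cs) (cong proj₂ e) (insertRow-below y below)
... | false = a<c ∷ insertRow-below-bumped y below e

insertRow-bumps-below : ∀ y {as cs b as′} → Pointwise _>_ cs as → insertRow y as ≡ (just b , as′) →
                        ∃₂ λ c cs′ → insertRow b cs ≡ (just c , cs′)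
insertRow-bumps-below y {a ∷ as} {c ∷ cs} (a<c ∷ below) eq with y <ᵇ a
insertRow-bumps-below y {a ∷ as} {c ∷ cs} (a<c ∷ below) refl | true = c , a ∷ cs , insertRow-bump cs a<c
... | false with insertRow y as in e
insertRow-bumps-below y {a ∷ as} {c ∷ cs} (a<c ∷ below) refl | false | just b , r
  with b <ᵇ c | insertRow-bumps-below y below e
... | true  | _              = c , b ∷ cs , refl
... | false | d , cs′ , bump = d , c ∷ cs′ , cong (map₂ (c ∷_)) bump

below-positive : ∀ {r₁ r₂} → Prefix _>_ r₂ r₁ → All (1 ≤_) r₁ → All (2 ≤_) r₂
below-positive []            _           = []
below-positive (a<c ∷ below) (1≤a ∷ pos) = ≤-trans (s≤s 1≤a) a<c ∷ below-positive below pos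

-- Restriction to the letters ≤ k

restrict : ℕ → List ℕ → List ℕ
restrict k = filter (_≤? k)

restrictRows : ℕ → Tableau → Tableau
restrictRows k = map (restrict k)

rowAt-restrictRows : ∀ k i T → rowAt i (restrictRows k T) ≡ restrict k (rowAt i T)
rowAt-restrictRows k i       []       = refl
rowAt-restrictRows k zero    (r ∷ rs) = refl
rowAt-restrictRows k (suc i) (r ∷ rs) = rowAt-restrictRows k i rs

insertWord : Tableau → Word → Tableau
insertWord = foldl (λ T x → insert x T)

infix 4 _≋_

-- Equality up to trailing empty rows.
record _≋_ (T T′ : Tableau) : Set where
  constructor rows≡
  field rowAt-≡ : ∀ i → rowAt i T ≡ rowAt i T′
open _≋_

≋-trans : ∀ {T T′ T″} → T ≋ T′ → T′ ≋ T″ → T ≋ T″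
≋-trans p q = rows≡ λ i → trans (rowAt-≡ p i) (rowAt-≡ q i)

insert-≋ : ∀ y {T T′} → T ≋ T′ → insert y T ≋ insert y T′
insert-≋ y {[]}     {[]}       eq = rows≡ λ _ → refl
insert-≋ y {[]}     {r′ ∷ rs′} (rows≡ eq) with eq 0
... | refl = rows≡ λ { zero → refl ; (suc i) → eq (suc i) }
insert-≋ y {r ∷ rs} {[]}       (rows≡ eq) with eq 0
... | refl = rows≡ λ { zero → refl ; (suc i) → eq (suc i) }
insert-≋ y {r ∷ rs} {r′ ∷ rs′} (rows≡ eq) with eq 0
... | refl with insertRow y r
...   | nothing , r₁ = rows≡ λ { zero → refl ; (suc i) → eq (suc i) }
...   | just b  , r₁ =
  rows≡ λ { zero → refl ; (suc i) → rowAt-≡ (insert-≋ b {rs} {rs′} (rows≡ (eq ∘ suc))) i }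

restrict-∷-cong : ∀ k x {xs ys} → restrict k xs ≡ restrict k ys →
                  restrict k (x ∷ xs) ≡ restrict k (x ∷ ys)
restrict-∷-cong k x eq with x ≤? k
... | yes x≤k = trans (filter-accept (_≤? k) x≤k) (trans (cong (x ∷_) eq) (sym (filter-accept (_≤? k) x≤k)))
... | no  x≰k = trans (filter-reject (_≤? k) x≰k) (trans eq (sym (filter-reject (_≤? k) x≰k)))

restrict-insertRow-large : ∀ {k y} → k < y → ∀ r → restrict k (proj₂ (insertRow y r)) ≡ restrict k r
restrict-insertRow-large {k} {y} k<y [] = filter-reject (_≤? k) (<⇒≱ k<y)
restrict-insertRow-large {k} {y} k<y (x ∷ xs) with y <ᵇ x | <ᵇ-reflects-< y x
... | true  | ofʸ y<x =
  trans (filter-reject (_≤? k) (<⇒≱ k<y)) (sym (filter-reject (_≤? k) (<⇒≱ (<-trans k<y y<x))))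
... | false | _       = restrict-∷-cong k x (restrict-insertRow-large k<y xs)

restrictRows-insert-large : ∀ {k y} → k < y → ∀ T → restrictRows k (insert y T) ≋ restrictRows k T
restrictRows-insert-large k<y [] = rows≡ λ { zero → restrict-insertRow-large k<y [] ; (suc i) → refl }
restrictRows-insert-large {k} {y} k<y (r ∷ rs)
  with insertRow y r | restrict-insertRow-large k<y r | insertRow-bumped> y r
... | nothing , r′ | eq | _ = rows≡ λ { zero → eq ; (suc i) → refl }
... | just c  , r′ | eq | Maybe.just y<c =
  rows≡ λ { zero → eq ; (suc i) → rowAt-≡ (restrictRows-insert-large (<-trans k<y y<c) rs) i }

data RestrictedInsertion (k : ℕ) : Maybe ℕ × List ℕ → Maybe ℕ × List ℕ → Set where
  kept    : ∀ {c r r₀} → c ≤ k → restrict k r ≡ r₀ →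
            RestrictedInsertion k (just c , r) (just c , r₀)
  dropped : ∀ {b r r₀} → Maybe.All (k <_) b → restrict k r ≡ r₀ →
            RestrictedInsertion k (b , r) (nothing , r₀)

restrict-small++large : ∀ k xs {ys} → All (_≤ k) xs → All (k <_) ys → restrict k (xs ++ ys) ≡ xs
restrict-small++large k xs {ys} xs≤k k<ys = begin
  restrict k (xs ++ ys)            ≡⟨ filter-++ (_≤? k) xs ys ⟩
  restrict k xs ++ restrict k ys   ≡⟨ cong₂ _++_ (filter-all (_≤? k) xs≤k)
                                                 (filter-none (_≤? k) (All.map <⇒≱ k<ys)) ⟩
  xs ++ []                         ≡⟨ ++-identityʳ xs ⟩
  xs                               ∎
  where open ≡-Reasoning

restrict-++-boundedʳ : ∀ {k} w {u} → All (_≤ k) u → restrict k (w ++ u) ≡ restrict k w ++ u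
restrict-++-boundedʳ {k} w {u} u≤k =
  trans (filter-++ (_≤? k) w u) (cong (restrict k w ++_) (filter-all (_≤? k) u≤k))

restrict-++-boundedˡ : ∀ {k u} w → All (_≤ k) u → restrict k (u ++ w) ≡ u ++ restrict k w
restrict-++-boundedˡ {k} {u} w u≤k =
  trans (filter-++ (_≤? k) u w) (cong (_++ restrict k w) (filter-all (_≤? k) u≤k))

insertRow-restrict-small++large : ∀ {k y} → y ≤ k → ∀ xs ys → All (_≤ k) xs → All (k <_) ys →
  RestrictedInsertion k (insertRow y (xs ++ ys)) (insertRow y xs)
insertRow-restrict-small++large {k} {y} y≤k xs ys xs≤k k<ys
  with insertRow y xs in e | insertRow-bumped-All {P = _≤ k} y xs≤k | insertRow-All {y = y} y≤k xs≤k
... | just c , xs′ | Maybe.just c≤k | xs′≤k rewrite insertRow-++ˡ xs ys e =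
  kept c≤k (restrict-small++large k xs′ xs′≤k k<ys)
... | nothing , xs′ | _ | xs′≤k
  with xs≤y ← insertRow-nothing⇒≤ xs e
  with refl ← cong proj₂ (trans (sym e) (insertRow-append xs xs≤y))
  rewrite insertRow-++ʳ xs ys xs≤y = appended ys k<ys
  where
  appended : ∀ ys → All (k <_) ys →
             RestrictedInsertion k (map₂ (xs ++_) (insertRow y ys)) (nothing , xs ++ [ y ])
  appended []       _            = dropped Maybe.nothing (filter-all (_≤? k) xs′≤k)
  appended (c ∷ cs) (k<c ∷ k<cs) rewrite insertRow-bump cs (≤-<-trans y≤k k<c) =
    dropped (Maybe.just k<c) (trans (cong (restrict k) (sym (++-assoc xs [ y ] cs)))
                                    (restrict-small++large k (xs ++ [ y ]) xs′≤k k<cs))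

data SplitAt (k : ℕ) : List ℕ → Set where
  split : ∀ xs ys → All (_≤ k) xs → All (k <_) ys → SplitAt k (xs ++ ys)

sorted-splitAt : ∀ k {r} → Sorted r → SplitAt k r
sorted-splitAt k [] = split [] [] [] []
sorted-splitAt k {x ∷ xs} (x≤xs ∷ sorted) with x ≤? k
... | no  x≰k = split [] (x ∷ xs) [] (≰⇒> x≰k ∷ All.map (<-≤-trans (≰⇒> x≰k)) x≤xs)
... | yes x≤k with sorted-splitAt k sorted
...   | split as bs as≤k k<bs = split (x ∷ as) bs (x≤k ∷ as≤k) k<bs

insertRow-restrict : ∀ {k y r} → y ≤ k → Sorted r →
                     RestrictedInsertion k (insertRow y r) (insertRow y (restrict k r))
insertRow-restrict {k} y≤k sorted with sorted-splitAt k sorted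
... | split xs ys xs≤k k<ys rewrite restrict-small++large k xs xs≤k k<ys =
  insertRow-restrict-small++large y≤k xs ys xs≤k k<ys

restrictRows-insert-small : ∀ {k y} → y ≤ k → ∀ {T} → All Sorted T →
                            restrictRows k (insert y T) ≋ insert y (restrictRows k T)
restrictRows-insert-small {k} y≤k {[]} [] =
  rows≡ λ { zero → filter-accept (_≤? k) y≤k ; (suc i) → refl }
restrictRows-insert-small {k} {y} y≤k {r ∷ rs} (sorted ∷ sorteds)
  with insertRow y r | insertRow y (restrict k r) | insertRow-restrict {k} y≤k sorted
... | just c , r′ | just c , r₀ | kept c≤k eq =
  rows≡ λ { zero → eq ; (suc i) → rowAt-≡ (restrictRows-insert-small c≤k sorteds) i }
... | nothing , r′ | nothing , r₀ | dropped Maybe.nothing eq =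
  rows≡ λ { zero → eq ; (suc i) → refl }
... | just c , r′ | nothing , r₀ | dropped (Maybe.just k<c) eq =
  rows≡ λ { zero → eq ; (suc i) → rowAt-≡ (restrictRows-insert-large k<c rs) i }

insert-sorted : ∀ y {T} → All Sorted T → All Sorted (insert y T)
insert-sorted y [] = ([] ∷ []) ∷ []
insert-sorted y {r ∷ rs} (sorted ∷ sorteds) with insertRow y r | insertRow-sorted y sorted
... | nothing , r′ | sorted′ = sorted′ ∷ sorteds
... | just b  , r′ | sorted′ = sorted′ ∷ insert-sorted b sorteds

restrictRows-insertWord : ∀ k {T T′} w → All Sorted T → restrictRows k T ≋ T′ →
                          restrictRows k (insertWord T w) ≋ insertWord T′ (restrict k w)
restrictRows-insertWord k [] _ eq = eq
restrictRows-insertWord k {T} (y ∷ w) sorteds eq with y ≤? k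
... | yes y≤k rewrite filter-accept (_≤? k) {xs = w} y≤k =
  restrictRows-insertWord k w (insert-sorted y sorteds)
    (≋-trans (restrictRows-insert-small y≤k sorteds) (insert-≋ y eq))
... | no  y≰k rewrite filter-reject (_≤? k) {xs = w} y≰k =
  restrictRows-insertWord k w (insert-sorted y sorteds)
    (≋-trans (restrictRows-insert-large (≰⇒> y≰k) T) eq)

restrict-rowAt-P : ∀ k w i → restrict k (rowAt i (P w)) ≡ rowAt i (P (restrict k w))
restrict-rowAt-P k w i =
  trans (sym (rowAt-restrictRows k i (P w))) (rowAt-≡ (restrictRows-insertWord k w [] (rows≡ λ _ → refl)) i)

-- The first two rows

RowPair : Set
RowPair = List ℕ × List ℕ

topRows : Tableau → RowPair
topRows T = rowAt 0 T , rowAt 1 T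

bumpInto : Maybe ℕ × List ℕ → List ℕ → Maybe ℕ × RowPair
bumpInto (nothing , r₁) r₂ = nothing , r₁ , r₂
bumpInto (just b  , r₁) r₂ = map₂ (r₁ ,_) (insertRow b r₂)

insertPair : ℕ → RowPair → Maybe ℕ × RowPair
insertPair y (r₁ , r₂) = bumpInto (insertRow y r₁) r₂

insertBumped : Maybe ℕ → Tableau → Tableau
insertBumped nothing  T = T
insertBumped (just b) T = insert b T

insert-via-insertPair : ∀ y T →
  topRows (insert y T) ≡ proj₂ (insertPair y (topRows T))
  × drop 2 (insert y T) ≡ insertBumped (proj₁ (insertPair y (topRows T))) (drop 2 T)
insert-via-insertPair y [] = refl , refl
insert-via-insertPair y (r ∷ []) with insertRow y r
... | nothing , r′ = refl , refl
... | just b  , r′ = refl , refl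
insert-via-insertPair y (r₁ ∷ r₂ ∷ rs) with insertRow y r₁
... | nothing , r₁′ = refl , refl
... | just b  , r₁′ with insertRow b r₂
...   | nothing , r₂′ = refl , refl
...   | just c  , r₂′ = refl , refl

insertWord-preserves : ∀ {Q : ℕ → Set} (I : Tableau → Set) →
                       (∀ {y} T → Q y → I T → I (insert y T)) →
                       ∀ {T} u → All Q u → I T → I (insertWord T u)
insertWord-preserves I step     []      []        i = i
insertWord-preserves I step {T} (y ∷ u) (qy ∷ qu) i = insertWord-preserves I step u qu (step T qy i)

insertWord-simulates : ∀ {Q : ℕ → Set} (R : Tableau → Tableau → Set) →
                       (∀ {y} S T → Q y → R S T → R (insert y S) (insert y T)) →
                       ∀ {S T} u → All Q u → R S T → R (insertWord S u) (insertWord T u)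
insertWord-simulates R step         []      []        r = r
insertWord-simulates R step {S} {T} (y ∷ u) (qy ∷ qu) r = insertWord-simulates R step u qu (step S T qy r)

AtMost2 : RowPair → Set
AtMost2 (r₁ , r₂) = All (_≤ 2) r₁ × All (_≤ 2) r₂

insertPair-1or2 : ∀ {y} → 1 ≤ y → y ≤ 2 → ∀ {rows} → AtMost2 rows →
                  proj₁ (insertPair y rows) ≡ nothing × AtMost2 (proj₂ (insertPair y rows))
insertPair-1or2 {y} 1≤y y≤2 {r₁ , r₂} (r₁≤2 , r₂≤2)
  with insertRow y r₁ | insertRow-All y≤2 r₁≤2 | insertRow-bumped-All y r₁≤2 | insertRow-bumped> y r₁
... | nothing , r₁′ | r₁′≤2 | _ | _ = refl , r₁′≤2 , r₂≤2
... | just b  , r₁′ | r₁′≤2 | Maybe.just b≤2 | Maybe.just y<b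
  rewrite insertRow-append r₂ (All.map (λ x≤2 → ≤-trans x≤2 (≤-trans (s≤s 1≤y) y<b)) r₂≤2) =
  refl , r₁′≤2 , All.++⁺ r₂≤2 (b≤2 ∷ [])

insert-1or2 : ∀ {y} → 1 ≤ y → y ≤ 2 → ∀ T → AtMost2 (topRows T) →
              AtMost2 (topRows (insert y T)) × drop 2 (insert y T) ≡ drop 2 T
insert-1or2 {y} 1≤y y≤2 T small with insert-via-insertPair y T | insertPair-1or2 1≤y y≤2 small
... | top≡ , rest≡ | noBump , small′ rewrite noBump = subst AtMost2 (sym top≡) small′ , rest≡

-- Prepending a letter

data SlidUp : RowPair → RowPair → Set where
  stay  : ∀ {rows} → SlidUp rows rows
  slide : ∀ as as′ cs cs′ e → length as ≡ length cs →
          SlidUp (as ++ e ∷ as′ , cs ++ cs′) (as ++ as′ , cs ++ e ∷ cs′)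

slide-next : ∀ as {as′ cs cs′ y e a} → length as ≡ length cs →
             SlidUp (as ++ y ∷ a ∷ as′ , cs ++ e ∷ cs′) (as ++ y ∷ as′ , cs ++ e ∷ a ∷ cs′)
slide-next as {as′} {cs} {cs′} {y} {e} {a} len =
  subst₂ SlidUp (cong₂ _,_ (++-assoc as [ y ] (a ∷ as′)) (++-assoc cs [ e ] cs′))
                (cong₂ _,_ (++-assoc as [ y ] as′) (++-assoc cs [ e ] (a ∷ cs′)))
                (slide (as ++ [ y ]) as′ (cs ++ [ e ]) cs′ a len′)
  where
  len′ : length (as ++ [ y ]) ≡ length (cs ++ [ e ])
  len′ = trans (length-++ as) (trans (cong (_+ 1) len) (sym (length-++ cs)))

SlidUp-All : ∀ {Q : ℕ → Set} {S U} → SlidUp S U →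
             All Q (proj₁ U) → All Q (proj₂ U) → All Q (proj₁ S) × All Q (proj₂ S)
SlidUp-All stay q₁ q₂ = q₁ , q₂
SlidUp-All (slide as as′ cs cs′ e _) q₁ q₂ with All.++⁻ as q₁ | All.++⁻ cs q₂
... | qas , qas′ | qcs , qe ∷ qcs′ = All.++⁺ qas (qe ∷ qas′) , All.++⁺ qcs qcs′

SlidUpAfter : Maybe ℕ × RowPair → Maybe ℕ × RowPair → Set
SlidUpAfter (b , S) (c , U) = b ≡ c × SlidUp S U

module _ (y : ℕ) (as as′ cs cs′ : List ℕ) (e : ℕ) (len : length as ≡ length cs) where

  slide-bumpsBefore : ∀ {b as₁} → insertRow y as ≡ (just b , as₁) →
                      Prefix _>_ (cs ++ cs′) (as ++ e ∷ as′) →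
                      SlidUpAfter (insertPair y (as ++ e ∷ as′ , cs ++ cs′))
                                  (insertPair y (as ++ as′ , cs ++ e ∷ cs′))
  slide-bumpsBefore {as₁ = as₁} bumpAs strictS
    with insertRow-bumps-below y (prefix-++⁻ˡ cs as (sym len) strictS) bumpAs
  ... | c , cs₁ , bumpCs
    rewrite insertRow-++ˡ as (e ∷ as′) bumpAs | insertRow-++ˡ as as′ bumpAs
          | insertRow-++ˡ cs cs′ bumpCs | insertRow-++ˡ cs (e ∷ cs′) bumpCs =
    refl , slide as₁ as′ cs₁ cs′ e
                 (trans (insertRow-length as bumpAs) (trans len (sym (insertRow-length cs bumpCs))))

  slide-bumpsSlid : All (_≤ y) as → y < e → Sorted (as ++ e ∷ as′) → Sorted (cs ++ e ∷ cs′) →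
                    Prefix _>_ (cs ++ e ∷ cs′) (0 ∷ as ++ as′) →
                    SlidUpAfter (insertPair y (as ++ e ∷ as′ , cs ++ cs′))
                                (insertPair y (as ++ as′ , cs ++ e ∷ cs′))
  slide-bumpsSlid as≤y y<e sortedS₁ sortedU₂ strictU
    rewrite insertRow-++ʳ as (e ∷ as′) as≤y | insertRow-bump as′ y<e | insertRow-++ʳ as as′ as≤y
          | insertRow-++ʳ cs cs′ (sorted-before cs sortedU₂) = go as′ cs′ sortedS₁ sortedU₂ strictU
    where
    go : ∀ as′ cs′ → Sorted (as ++ e ∷ as′) → Sorted (cs ++ e ∷ cs′) →
         Prefix _>_ (cs ++ e ∷ cs′) (0 ∷ as ++ as′) →
         SlidUpAfter (map₂ (as ++ y ∷ as′ ,_) (map₂ (cs ++_) (insertRow e cs′)))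
                     (bumpInto (map₂ (as ++_) (insertRow y as′)) (cs ++ e ∷ cs′))
    go []        []        _ _ _ = refl , stay
    go []        (c ∷ cs′) _ _ strictU with prefix-shifted cs as (sym len) strictU
    ... | ()
    go (a ∷ as′) cs′ sortedS₁ sortedU₂ strictU
      with e≤a ∷ _ ← sorted-after as sortedS₁
      rewrite insertRow-bump as′ (<-≤-trans y<e e≤a)
            | insertRow-++ʳ cs (e ∷ cs′) (All.map (λ c≤e → ≤-trans c≤e e≤a) (sorted-before cs sortedU₂))
            | insertRow-pass cs′ e≤a = a-passes-e cs′ (prefix-shifted cs as (sym len) strictU)
      where
      a-passes-e : ∀ cs′ → Prefix _>_ cs′ (a ∷ as′) →
                   SlidUpAfter (map₂ (as ++ y ∷ a ∷ as′ ,_) (map₂ (cs ++_) (insertRow e cs′)))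
                               (map₂ (as ++ y ∷ as′ ,_) (map₂ (cs ++_) (map₂ (e ∷_) (insertRow a cs′))))
      a-passes-e []        _ = refl , slide-next as len
      a-passes-e (c ∷ cs′) (a<c ∷ _)
        rewrite insertRow-bump cs′ (≤-<-trans e≤a a<c) | insertRow-bump cs′ a<c =
        refl , slide-next as len

  slide-passesSlid : All (_≤ y) as → e ≤ y → Sorted (cs ++ e ∷ cs′) →
                     SlidUpAfter (insertPair y (as ++ e ∷ as′ , cs ++ cs′))
                                 (insertPair y (as ++ as′ , cs ++ e ∷ cs′))
  slide-passesSlid as≤y e≤y sortedU₂
    rewrite insertRow-++ʳ as (e ∷ as′) as≤y | insertRow-pass as′ e≤y | insertRow-++ʳ as as′ as≤y
    with insertRow y as′ | insertRow-bumped> y as′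
  ... | nothing , as₁ | _ = refl , slide as as₁ cs cs′ e len
  ... | just b  , as₁ | Maybe.just y<b
    with e≤b ← ≤-trans e≤y (<⇒≤ y<b)
    with cs≤b ← All.map (λ c≤e → ≤-trans c≤e e≤b) (sorted-before cs sortedU₂)
    rewrite insertRow-++ʳ cs cs′ cs≤b | insertRow-++ʳ cs (e ∷ cs′) cs≤b | insertRow-pass cs′ e≤b =
    refl , slide as as₁ cs (proj₂ (insertRow b cs′)) e len

insertPair-SlidUp : ∀ y {S U} → Sorted (proj₁ S) → Prefix _>_ (proj₂ S) (proj₁ S) →
                    Sorted (proj₂ U) → Prefix _>_ (proj₂ U) (0 ∷ proj₁ U) →
                    SlidUp S U → SlidUpAfter (insertPair y S) (insertPair y U)
insertPair-SlidUp y _ _ _ _ stay = refl , stay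
insertPair-SlidUp y sortedS₁ strictS sortedU₂ strictU (slide as as′ cs cs′ e len)
  with insertRow y as in insertAs
... | just b  , as₁ = slide-bumpsBefore y as as′ cs cs′ e len insertAs strictS
... | nothing , _ with as≤y ← insertRow-nothing⇒≤ as insertAs with y <? e
...   | yes y<e = slide-bumpsSlid y as as′ cs cs′ e len as≤y y<e sortedS₁ sortedU₂ strictU
...   | no  y≮e = slide-passesSlid y as as′ cs cs′ e len as≤y (≮⇒≥ y≮e) sortedU₂

Semistandard₂ : RowPair → Set
Semistandard₂ (r₁ , r₂) = Sorted r₁ × Sorted r₂ × Prefix _>_ r₂ r₁ × All (1 ≤_) r₁

insertPair-Semistandard₂ : ∀ {y} → 1 ≤ y → ∀ {rows} → Semistandard₂ rows →
                           Semistandard₂ (proj₂ (insertPair y rows))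
insertPair-Semistandard₂ {y} 1≤y {r₁ , r₂} (sorted₁ , sorted₂ , strict , pos)
  with insertRow y r₁ in bump | insertRow-sorted y sorted₁ | insertRow-All 1≤y pos | insertRow-below y strict
... | nothing , r₁′ | sorted₁′ | pos′ | strict′ = sorted₁′ , sorted₂ , strict′ , pos′
... | just b  , r₁′ | sorted₁′ | pos′ | _       =
  sorted₁′ , insertRow-sorted b sorted₂ , insertRow-below-bumped y strict bump , pos′

pushTwo : RowPair → RowPair
pushTwo = map₂ (2 ∷_)

insertPair-pushTwo : ∀ {y} → 1 ≤ y → ∀ rows →
                     insertPair y (pushTwo rows) ≡ map₂ pushTwo (insertPair y rows)
insertPair-pushTwo {y} 1≤y (r₁ , r₂) with insertRow y r₁ | insertRow-bumped> y r₁
... | nothing , _   | _              = refl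
... | just b  , r₁′ | Maybe.just y<b = cong (map₂ (r₁′ ,_)) (insertRow-pass r₂ (≤-trans (s≤s 1≤y) y<b))

insertPair-SlidUp-pushTwo : ∀ {y} → 1 ≤ y → ∀ {S T} → Semistandard₂ S → Semistandard₂ T →
                            SlidUp S (pushTwo T) →
                            proj₁ (insertPair y S) ≡ proj₁ (insertPair y T)
                            × SlidUp (proj₂ (insertPair y S)) (pushTwo (proj₂ (insertPair y T)))
insertPair-SlidUp-pushTwo {y} 1≤y {S} {T} (sortedS₁ , _ , strictS , _) (_ , sortedT₂ , strictT , posT) slid =
  subst (SlidUpAfter (insertPair y S)) (insertPair-pushTwo 1≤y T)
    (insertPair-SlidUp y {U = pushTwo T} sortedS₁ strictS
       (below-positive strictT posT ∷ sortedT₂) (s≤s z≤n ∷ strictT) slid)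

Prepended2 : Tableau → Tableau → Set
Prepended2 S T = Semistandard₂ (topRows S) × Semistandard₂ (topRows T)
               × SlidUp (topRows S) (pushTwo (topRows T)) × drop 2 S ≡ drop 2 T

insert-Prepended2 : ∀ {y} S T → 1 ≤ y → Prepended2 S T → Prepended2 (insert y S) (insert y T)
insert-Prepended2 {y} S T 1≤y (semiS , semiT , slid , rest≡)
  with insert-via-insertPair y S | insert-via-insertPair y T | insertPair-SlidUp-pushTwo 1≤y semiS semiT slid
... | topS , restS | topT , restT | sameBump , slid′ =
  subst Semistandard₂ (sym topS) (insertPair-Semistandard₂ 1≤y semiS) ,
  subst Semistandard₂ (sym topT) (insertPair-Semistandard₂ 1≤y semiT) ,
  subst₂ SlidUp (sym topS) (cong pushTwo (sym topT)) slid′ ,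
  trans restS (trans (cong₂ insertBumped sameBump rest≡) (sym restT))

P-Prepended2 : ∀ {z} → All (1 ≤_) z → Prepended2 (P (2 ∷ z)) (P z)
P-Prepended2 {z} pos = insertWord-simulates Prepended2 insert-Prepended2 z pos
  (([] ∷ [] , [] , [] , s≤s z≤n ∷ []) , ([] , [] , [] , []) , slide [] [] [] [] 2 refl , refl)

consFirstRow : ℕ → Tableau → Tableau
consFirstRow x []       = [ [ x ] ]
consFirstRow x (r ∷ rs) = (x ∷ r) ∷ rs

insert-consFirstRow : ∀ {x y} → x ≤ y → ∀ T → insert y (consFirstRow x T) ≡ consFirstRow x (insert y T)
insert-consFirstRow x≤y [] rewrite insertRow-pass [] x≤y = refl
insert-consFirstRow {y = y} x≤y (r ∷ rs) rewrite insertRow-pass r x≤y with insertRow y r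
... | nothing , r′ = refl
... | just b  , r′ = refl

P-prepend-minimum : ∀ {x z} → All (x ≤_) z → P (x ∷ z) ≡ consFirstRow x (P z)
P-prepend-minimum {x} {z} x≤z =
  insertWord-simulates (λ S T → S ≡ consFirstRow x T)
                       (λ { _ T x≤y refl → insert-consFirstRow x≤y T }) z x≤z refl

consFirstRow-AtMost2 : ∀ {x} → x ≤ 2 → ∀ T → AtMost2 (topRows T) → AtMost2 (topRows (consFirstRow x T))
consFirstRow-AtMost2 x≤2 []       _            = (x≤2 ∷ []) , []
consFirstRow-AtMost2 x≤2 (r ∷ rs) (r≤2 , r₂≤2) = (x≤2 ∷ r≤2) , r₂≤2

drop2-consFirstRow : ∀ x T → drop 2 (consFirstRow x T) ≡ drop 2 T
drop2-consFirstRow x []       = refl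
drop2-consFirstRow x (r ∷ rs) = refl

OneOrTwo : ℕ → Set
OneOrTwo x = x ≡ 1 ⊎ x ≡ 2

oneOrTwo-bounds : ∀ {x} → OneOrTwo x → 1 ≤ x × x ≤ 2
oneOrTwo-bounds (inj₁ refl) = s≤s z≤n , s≤s z≤n
oneOrTwo-bounds (inj₂ refl) = s≤s z≤n , s≤s (s≤s z≤n)

P-prepend-1or2 : ∀ {x z} → OneOrTwo x → All (1 ≤_) z → AtMost2 (topRows (P z)) →
                 AtMost2 (topRows (P (x ∷ z))) × drop 2 (P (x ∷ z)) ≡ drop 2 (P z)
P-prepend-1or2 {z = z} (inj₁ refl) pos small rewrite P-prepend-minimum pos =
  consFirstRow-AtMost2 (s≤s z≤n) (P z) small , drop2-consFirstRow 1 (P z)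
P-prepend-1or2 (inj₂ refl) pos (r₁≤2 , r₂≤2) with P-Prepended2 pos
... | _ , _ , slid , rest≡ = SlidUp-All slid r₁≤2 (≤-refl ∷ r₂≤2) , rest≡

P-prepend : ∀ {u z} → All OneOrTwo u → All (1 ≤_) z → AtMost2 (topRows (P z)) →
            AtMost2 (topRows (P (u ++ z))) × drop 2 (P (u ++ z)) ≡ drop 2 (P z)
P-prepend []          pos small = small , refl
P-prepend (x12 ∷ u12) pos small with P-prepend u12 pos small
... | small′ , rest≡ with P-prepend-1or2 x12 (All.++⁺ (All.map (proj₁ ∘ oneOrTwo-bounds) u12) pos) small′
...   | small″ , rest≡′ = small″ , trans rest≡′ rest≡

P-append : ∀ w {u} → All OneOrTwo u → AtMost2 (topRows (P w)) →
           AtMost2 (topRows (P (w ++ u))) × drop 2 (P (w ++ u)) ≡ drop 2 (P w)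
P-append w {u} u12 small rewrite foldl-++ (λ T x → insert x T) [] w u =
  insertWord-preserves (λ T → AtMost2 (topRows T) × drop 2 T ≡ drop 2 (P w)) step u u12 (small , refl)
  where
  step : ∀ {y} T → OneOrTwo y → AtMost2 (topRows T) × drop 2 T ≡ drop 2 (P w) →
         AtMost2 (topRows (insert y T)) × drop 2 (insert y T) ≡ drop 2 (P w)
  step T y12 (small , rest≡) with 1≤y , y≤2 ← oneOrTwo-bounds y12 with insert-1or2 1≤y y≤2 T small
  ... | small′ , rest≡′ = small′ , trans rest≡′ rest≡

rowAt-drop : ∀ n i T → rowAt (n + i) T ≡ rowAt i (drop n T)
rowAt-drop zero    i T        = refl
rowAt-drop (suc n) i []       = refl
rowAt-drop (suc n) i (r ∷ rs) = rowAt-drop n i rs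

drop-≡⇒rowAt-≡ : ∀ n i T T′ → drop n T ≡ drop n T′ → rowAt (n + i) T ≡ rowAt (n + i) T′
drop-≡⇒rowAt-≡ n i T T′ eq = trans (rowAt-drop n i T) (trans (cong (rowAt i) eq) (sym (rowAt-drop n i T′)))

rowAt-P-restrict : ∀ {k} i z {v} → All (_≤ k) (rowAt i (P z)) → restrict k z ≡ v →
                   rowAt i (P z) ≡ rowAt i (P v)
rowAt-P-restrict {k} i z small refl = trans (sym (filter-all (_≤? k) small)) (restrict-rowAt-P k z i)

lemma2p3 : (n : ℕ) (u w : List ℕ)
    → length u ≡ n
    → All (λ x → x ≡ 1 ⊎ x ≡ 2) u
    → All (λ x → 1 ≤ x) w
    → 2 ≤ length (P w)
    → All (λ x → x ≤ 2) (R 1 w)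
    → All (λ x → x ≤ 2) (R 2 w)
    → ((i : ℕ) → 1 ≤ i → i ≤ 2
         → (R i (w ++ u) ≡ R i (restrict12 w ++ u))
           × (R i (u ++ w) ≡ R i (u ++ restrict12 w)))
      × ((i : ℕ) → 3 ≤ i
         → (R i (w ++ u) ≡ R i w) × (R i w ≡ R i (u ++ w)))
lemma2p3 n u w _ u12 w⁺ _ r₁≤2 r₂≤2 = rows1-2 , rows≥3
  where
  u≤2 : All (_≤ 2) u
  u≤2 = All.map (proj₂ ∘ oneOrTwo-bounds) u12
  wu : AtMost2 (topRows (P (w ++ u))) × drop 2 (P (w ++ u)) ≡ drop 2 (P w)
  wu = P-append w u12 (r₁≤2 , r₂≤2)
  uw : AtMost2 (topRows (P (u ++ w))) × drop 2 (P (u ++ w)) ≡ drop 2 (P w)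
  uw = P-prepend u12 w⁺ (r₁≤2 , r₂≤2)
  rows1-2 : (i : ℕ) → 1 ≤ i → i ≤ 2 →
            (R i (w ++ u) ≡ R i (restrict12 w ++ u)) × (R i (u ++ w) ≡ R i (u ++ restrict12 w))
  rows1-2 1 _ _ = rowAt-P-restrict 0 (w ++ u) (proj₁ (proj₁ wu)) (restrict-++-boundedʳ w u≤2)
                , rowAt-P-restrict 0 (u ++ w) (proj₁ (proj₁ uw)) (restrict-++-boundedˡ w u≤2)
  rows1-2 2 _ _ = rowAt-P-restrict 1 (w ++ u) (proj₂ (proj₁ wu)) (restrict-++-boundedʳ w u≤2)
                , rowAt-P-restrict 1 (u ++ w) (proj₂ (proj₁ uw)) (restrict-++-boundedˡ w u≤2)
  rows1-2 (suc (suc (suc _))) _ (s≤s (s≤s ()))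
  rows≥3 : (i : ℕ) → 3 ≤ i → (R i (w ++ u) ≡ R i w) × (R i w ≡ R i (u ++ w))
  rows≥3 1 (s≤s ())
  rows≥3 2 (s≤s (s≤s ()))
  rows≥3 (suc (suc (suc j))) _ = drop-≡⇒rowAt-≡ 2 j (P (w ++ u)) (P w) (proj₂ wu)
                               , drop-≡⇒rowAt-≡ 2 j (P w) (P (u ++ w)) (sym (proj₂ uw))
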